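{- Let $G$ be a parity game, let $\rho_0,\rho_1,\dots,\rho_t$ be a lifting sequence on $G$, and let $LH=(V_{LH},E_{LH})$ be the associated lifting history graph. If there is a path in $LH$ with at least one edge from a node $(w,m)$ to a node $(w,m')$ (same game vertex $w$), then $m>m'$.
   Context: Parity game $G=(V,E,\mathcal P,(V_\Diamond,V_\square))$: finite $V$ partitioned into $V_\Diamond$ (Even) and $V_\square$ (Odd), total $E$, priorities $\mathcal P:V\to\mathbb N$; $V_i$ = vertices of priority $i$; $d$ = one more than the largest priority. Measures: $\mathbb M^\Diamond$ = $\{\top\}$ plus $d$-tuples in $\mathbb N^d$ with $0$ at even positions and value $\le|V_i|$ at odd position $i$, ordered lexicographically with every tuple $<\top$; $\alpha<_i\beta$ compares positions $0..i$ only. $\mathrm{Prog}(\rho,v,w)$ for $(v,w)\in E$ is the least $m\in\mathbb M^\Diamond$ with $m\ge_{\mathcal P(v)}\rho(w)$ if $\mathcal P(v)$ even, and with $m>_{\mathcal P(v)}\rho(w)$ or $m=\rho(w)=\top$ if $\mathcal P(v)$ odd. $\mathrm{Lift}(\rho,v)$ replaces the value at $v$ by $\max\{\rho(v),\min_{(v,w)\in E}\mathrm{Prog}(\rho,v,w)\}$ if $v\in V_\Diamond$, resp. $\max\{\rho(v),\max_{(v,w)\in E}\mathrm{Prog}(\rho,v,w)\}$ if $v\in V_\square$. A lifting sequence is $\rho_0,\dots,\rho_t$ with $\rho_0\equiv(0,\dots,0)$ and $\rho_{j}=\mathrm{Lift}(\rho_{j-1},v_j)$ for some vertex $v_j$ with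 $\rho_j\neq\rho_{j-1}$. Lifting history graph: $V_{LH}=\{(v,m)\in V\times\mathbb M^\Diamond\mid \rho_i(v)=m\text{ for some }i\le t\}$, and $((v,m),(w,m'))\in E_{LH}$ iff $(v,w)\in E$ and there is $i\le t$ with $m=\rho_i(v)>\rho_{i-1}(v)$ and either $v\ne w$ and $\rho_{i-1}(w)=\rho_i(w)=m'$, or $v=w$ and $\rho_{i-1}(v)=m'$. -}

module Defs where

open import Data.Nat using (ℕ; zero; suc; _≤_; _<_; _⊔_; _%_; _≟_)
open import Data.Fin using (Fin)
open import Data.List using (List; length; filter; allFin; foldr)
import Data.List as List
open import Data.Vec using (Vec; []; _∷_)
open import Data.Product using (Σ; ∃; ∃-syntax; _×_; _,_)
open import Data.Sum using (_⊎_)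
open import Data.Empty using (⊥)
open import Data.Unit using (⊤)
open import Relation.Binary.PropositionalEquality using (_≡_; _≢_)
open import Relation.Binary.Construct.Closure.Transitive using (TransClosure)

data Player : Set where
  Even Odd : Player

record ParityGame : Set₁ where
  field
    n     : ℕ
    E     : Fin n → Fin n → Set
    total : ∀ v → ∃[ w ] E v w
    prio  : Fin n → ℕ
    owner : Fin n → Player

-- entry at position i of a vector (0 beyond its length)
at : ∀ {k} → Vec ℕ k → ℕ → ℕ
at []       _       = 0
at (x ∷ xs) zero    = x
at (x ∷ xs) (suc i) = at xs i

LtUpTo : ∀ {k} → ℕ → Vec ℕ k → Vec ℕ k → Set
LtUpTo k a b = ∃[ j ] (j < k × (∀ l → l < j → at a l ≡ at b l) × at a j < at b j)

EqUpTo : ∀ {k} → ℕ → Vec ℕ k → Vec ℕ k → Set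
EqUpTo k a b = ∀ l → l < k → at a l ≡ at b l

module Game (G : ParityGame) where
  open ParityGame G public

  maxPrio : ℕ
  maxPrio = foldr _⊔_ 0 (List.map prio (allFin n))

  d : ℕ
  d = suc maxPrio

  count : ℕ → ℕ
  count i = length (filter (λ v → prio v ≟ i) (allFin n))

  data Meas : Set where
    top : Meas
    tup : Vec ℕ d → Meas

  InM : Meas → Set
  InM top     = ⊤
  InM (tup a) = ∀ i → i < d → (i % 2 ≡ 0 → at a i ≡ 0) × (i % 2 ≡ 1 → at a i ≤ count i)

  _<[_]_ : Meas → ℕ → Meas → Set
  tup a <[ i ] tup b = LtUpTo (suc i) a b
  tup a <[ i ] top   = ⊤
  top   <[ i ] _     = ⊥

  _≤[_]_ : Meas → ℕ → Meas → Set
  tup a ≤[ i ] tup b = LtUpTo (suc i) a b ⊎ EqUpTo (suc i) a b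
  tup a ≤[ i ] top   = ⊤
  top   ≤[ i ] tup b = ⊥
  top   ≤[ i ] top   = ⊤

  _<ᴹ_ : Meas → Meas → Set
  α <ᴹ β = α <[ maxPrio ] β

  _≤ᴹ_ : Meas → Meas → Set
  α ≤ᴹ β = α <ᴹ β ⊎ α ≡ β

  Assignment : Set
  Assignment = Fin n → Meas

  ProgCond : Assignment → Fin n → Fin n → Meas → Set
  ProgCond ρ v w m with prio v % 2
  ... | 0 = ρ w ≤[ prio v ] m
  ... | _ = ρ w <[ prio v ] m ⊎ (m ≡ top × ρ w ≡ top)

  IsProg : Assignment → Fin n → Fin n → Meas → Set
  IsProg ρ v w m = InM m × ProgCond ρ v w m
                 × (∀ m' → InM m' → ProgCond ρ v w m' → m ≤ᴹ m')

  IsOpt : Assignment → Fin n → Meas → Set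
  IsOpt ρ v o with owner v
  ... | Even = (∃[ w ] (E v w × IsProg ρ v w o))
             × (∀ w m → E v w → IsProg ρ v w m → o ≤ᴹ m)
  ... | Odd  = (∃[ w ] (E v w × IsProg ρ v w o))
             × (∀ w m → E v w → IsProg ρ v w m → m ≤ᴹ o)

  IsMax : Meas → Meas → Meas → Set
  IsMax a b c = (c ≡ a ⊎ c ≡ b) × a ≤ᴹ c × b ≤ᴹ c

  IsLift : Assignment → Fin n → Assignment → Set
  IsLift ρ v ρ' = (∀ u → u ≢ v → ρ' u ≡ ρ u)
                × ∃[ o ] (IsOpt ρ v o × IsMax (ρ v) o (ρ' v))

  zeroMeas : Meas
  zeroMeas = tup (Data.Vec.replicate d 0)
    where import Data.Vec

  -- ρ_0,…,ρ_t is a lifting sequence (ρ is only relevant on indices ≤ t)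
  IsLiftingSeq : ℕ → (ℕ → Assignment) → Set
  IsLiftingSeq t ρ = (∀ u → ρ 0 u ≡ zeroMeas)
                   × (∀ j → suc j ≤ t → ∃[ v ] (IsLift (ρ j) v (ρ (suc j))
                                              × ∃[ u ] (ρ (suc j) u ≢ ρ j u)))

  Node : Set
  Node = Fin n × Meas

  InVLH : ℕ → (ℕ → Assignment) → Node → Set
  InVLH t ρ (v , m) = ∃[ i ] (i ≤ t × ρ i v ≡ m)

  ELH : ℕ → (ℕ → Assignment) → Node → Node → Set
  ELH t ρ (v , m) (w , m') =
    E v w × ∃[ j ] (suc j ≤ t × m ≡ ρ (suc j) v × ρ j v <ᴹ ρ (suc j) v
      × ((v ≢ w × ρ j w ≡ m' × ρ (suc j) w ≡ m')
         ⊎ (v ≡ w × ρ j v ≡ m')))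

  PathLH : ℕ → (ℕ → Assignment) → Node → Node → Set
  PathLH t ρ = TransClosure (ELH t ρ)

-- Lifting only increases measures, so along a lifting sequence every vertex's
-- measure is monotone in time.  An LH edge leaving (v , m) is created by the lift
-- at step j+1 that raised v to m, and its target carries the value ρ_j of its
-- vertex.  Along a path these step indices strictly decrease: the next edge
-- leaves (y , m₁) with m₁ = ρ_j y, and the step that raised y to m₁ must come
-- before j.  Hence a path from (w , m) to (w , m') ends at a value ρ_k w with
-- k ≤ j, which is at most ρ_j w < ρ_{j+1} w = m.
module Submission where

open import Defs
open import Data.Nat using (ℕ; suc; _≤_; _<_; _≤?_; s≤s)
open import Data.Nat.Properties
  using (<-cmp; <-trans; <-irrefl; ≤-refl; ≤-trans; <⇒≤; ≰⇒>; m≤n⇒m<n∨m≡n)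
open import Data.Fin using (Fin)
import Data.Fin as Fin
open import Data.Vec using (Vec)
open import Data.Product using (_,_; proj₁; proj₂; ∃-syntax; _×_)
open import Data.Sum using (inj₁; inj₂)
open import Data.Empty using (⊥; ⊥-elim)
open import Data.Unit using (tt)
open import Relation.Nullary using (yes; no)
open import Relation.Binary using (tri<; tri≈; tri>)
open import Relation.Binary.PropositionalEquality using (_≡_; refl; sym; trans; subst)
open import Relation.Binary.Construct.Closure.Transitive using ([_]; _∷_)

LtUpTo-trans : ∀ {k} K {a b c : Vec ℕ k} → LtUpTo K a b → LtUpTo K b c → LtUpTo K a c
LtUpTo-trans K {a} {b} {c} (i , i<K , a≈b , aᵢ<bᵢ) (j , j<K , b≈c , bⱼ<cⱼ) with <-cmp i j
... | tri< i<j _ _ =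
  i , i<K , (λ l l<i → trans (a≈b l l<i) (b≈c l (<-trans l<i i<j)))
    , subst (at a i <_) (b≈c i i<j) aᵢ<bᵢ
... | tri≈ _ refl _ =
  i , i<K , (λ l l<i → trans (a≈b l l<i) (b≈c l l<i)) , <-trans aᵢ<bᵢ bⱼ<cⱼ
... | tri> _ _ j<i =
  j , j<K , (λ l l<j → trans (a≈b l (<-trans l<j j<i)) (b≈c l l<j))
    , subst (_< at c j) (sym (a≈b j j<i)) bⱼ<cⱼ

LtUpTo-irrefl : ∀ {k} K {a : Vec ℕ k} → LtUpTo K a a → ⊥
LtUpTo-irrefl K (_ , _ , _ , aⱼ<aⱼ) = <-irrefl refl aⱼ<aⱼ

module _ (G : ParityGame) where
  open Game G

  <ᴹ-trans : ∀ {α β γ} → α <ᴹ β → β <ᴹ γ → α <ᴹ γ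
  <ᴹ-trans {tup a} {tup b} {tup c} α<β β<γ = LtUpTo-trans _ {a} {b} {c} α<β β<γ
  <ᴹ-trans {tup a} {tup b} {top}   _   _   = tt
  <ᴹ-trans {tup a} {top}   {top}   _   _   = tt

  <ᴹ-irrefl : ∀ {α} → α <ᴹ α → ⊥
  <ᴹ-irrefl {tup a} α<α = LtUpTo-irrefl _ {a} α<α

  ≤ᴹ-<ᴹ-trans : ∀ {α β γ} → α ≤ᴹ β → β <ᴹ γ → α <ᴹ γ
  ≤ᴹ-<ᴹ-trans (inj₁ α<β) β<γ = <ᴹ-trans α<β β<γ
  ≤ᴹ-<ᴹ-trans (inj₂ refl) β<γ = β<γ

  ≤ᴹ-trans : ∀ {α β γ} → α ≤ᴹ β → β ≤ᴹ γ → α ≤ᴹ γ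
  ≤ᴹ-trans α≤β (inj₁ β<γ) = inj₁ (≤ᴹ-<ᴹ-trans α≤β β<γ)
  ≤ᴹ-trans α≤β (inj₂ refl) = α≤β

  lift-increasing : ∀ {ρ v ρ'} → IsLift ρ v ρ' → ∀ y → ρ y ≤ᴹ ρ' y
  lift-increasing {v = v} (unchanged , _ , _ , _ , ρv≤ρ'v , _) y with y Fin.≟ v
  ... | yes refl = ρv≤ρ'v
  ... | no y≢v   = inj₂ (sym (unchanged y y≢v))

  module _ {t : ℕ} {ρ : ℕ → Assignment} (seq : IsLiftingSeq t ρ) where

    liftingSeq-mono : ∀ {i} j → i ≤ j → j ≤ t → ∀ y → ρ i y ≤ᴹ ρ j y
    liftingSeq-mono {i} j i≤j j≤t y with m≤n⇒m<n∨m≡n i≤j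
    ... | inj₂ refl = inj₂ refl
    liftingSeq-mono (suc j) _ j<t y | inj₁ (s≤s i≤j) =
      ≤ᴹ-trans (liftingSeq-mono j i≤j (<⇒≤ j<t) y)
               (lift-increasing (proj₁ (proj₂ (proj₂ seq j j<t))) y)

    LiftedAt : ℕ → Node → Set
    LiftedAt j (v , m) = suc j ≤ t × m ≡ ρ (suc j) v × ρ j v <ᴹ ρ (suc j) v

    lifted-before : ∀ {i j y m} → LiftedAt j (y , m) → ρ i y ≡ m → j < i
    lifted-before {i} {j} {y} (j<t , refl , raised) ρᵢy≡m with i ≤? j
    ... | no i≰j = ≰⇒> i≰j
    ... | yes i≤j = ⊥-elim (<ᴹ-irrefl (≤ᴹ-<ᴹ-trans (liftingSeq-mono j i≤j (<⇒≤ j<t) y)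
                                        (subst (ρ j y <ᴹ_) (sym ρᵢy≡m) raised)))

    ELH-lifted : ∀ {v m x m'} → ELH t ρ (v , m) (x , m') →
                 ∃[ j ] (LiftedAt j (v , m) × ρ j x ≡ m')
    ELH-lifted (_ , j , j<t , m≡ , raised , inj₁ (_ , ρⱼx≡m' , _)) = j , (j<t , m≡ , raised) , ρⱼx≡m'
    ELH-lifted (_ , j , j<t , m≡ , raised , inj₂ (refl , ρⱼx≡m')) = j , (j<t , m≡ , raised) , ρⱼx≡m'

    PathLH-lifted : ∀ {a x m'} → PathLH t ρ a (x , m') →
                    ∃[ j ] (LiftedAt j a × ∃[ k ] (k ≤ j × ρ k x ≡ m'))
    PathLH-lifted [ e ] with ELH-lifted e
    ... | j , lifted , ρⱼx≡m' = j , lifted , j , ≤-refl , ρⱼx≡m'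
    PathLH-lifted (e ∷ p) with ELH-lifted e | PathLH-lifted p
    ... | j , lifted , ρⱼy≡m₁ | j₁ , lifted₁ , k , k≤j₁ , ρₖx≡m' =
      j , lifted , k , ≤-trans k≤j₁ (<⇒≤ (lifted-before lifted₁ ρⱼy≡m₁)) , ρₖx≡m'

proposition4 : (G : ParityGame) → let open Game G in
    (t : ℕ) (ρ : ℕ → Assignment) → IsLiftingSeq t ρ →
    (w : Fin n) (m m' : Meas) →
    PathLH t ρ (w , m) (w , m') → m' <ᴹ m
proposition4 G t ρ seq w m m' path with PathLH-lifted G seq path
... | j , (j<t , refl , raised) , k , k≤j , refl =
  ≤ᴹ-<ᴹ-trans G (liftingSeq-mono G seq j k≤j (<⇒≤ j<t) w) raised
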